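{- Let $k\in\mathbb{Z}[i]$ with $|k|>2.5$. Define $(V_n)_{n\geqslant0}$ by $V_0=1$, $V_1=2k-1$, $V_{n+2}=2kV_{n+1}-V_n$, and for $j=1,\dots,6$ define $(W_m^{(j)})_{m\geqslant0}$ by $W_{m+2}^{(j)}=2(4k^2-2k-1)W_{m+1}^{(j)}-W_m^{(j)}$ with initial values \[W_0^{(1)}=1,\ W_1^{(1)}=4k^2-k-2;\quad W_0^{(2)}=1,\ W_1^{(2)}=4k^2-3k;\quad W_0^{(3)}=k,\ W_1^{(3)}=8k^3-4k^2-4k+1;\] \[W_0^{(4)}=k,\ W_1^{(4)}=2k-1;\quad W_0^{(5)}=2k-1,\ W_1^{(5)}=16k^3-16k^2-k+2;\quad W_0^{(6)}=2k-1,\ W_1^{(6)}=k.\] If $V_n=\pm W_m^{(j)}$ for some $j\in\{1,\dots,6\}$ and $m,n\in\mathbb{N}_0$, then $m\leqslant n\leqslant 3m+2$. -}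

module Defs where

open import Data.Nat using (ℕ; zero; suc)
open import Data.Fin using (Fin; zero; suc)
open import Data.Integer as ℤ using (ℤ; +_; 0ℤ; 1ℤ)

record ℤ[i] : Set where
  constructor _+_i
  field
    re : ℤ
    im : ℤ
open ℤ[i] public

infixl 6 _+ᵍ_ _-ᵍ_
infixl 7 _*ᵍ_

_+ᵍ_ : ℤ[i] → ℤ[i] → ℤ[i]
(a + b i) +ᵍ (c + d i) = (a ℤ.+ c) + (b ℤ.+ d) i

-ᵍ_ : ℤ[i] → ℤ[i]
-ᵍ (a + b i) = (ℤ.- a) + (ℤ.- b) i

_-ᵍ_ : ℤ[i] → ℤ[i] → ℤ[i]
x -ᵍ y = x +ᵍ (-ᵍ y)

_*ᵍ_ : ℤ[i] → ℤ[i] → ℤ[i]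
(a + b i) *ᵍ (c + d i) = (a ℤ.* c ℤ.- b ℤ.* d) + (a ℤ.* d ℤ.+ b ℤ.* c) i

ι : ℤ → ℤ[i]
ι n = n + 0ℤ i

normSq : ℤ[i] → ℤ
normSq (a + b i) = a ℤ.* a ℤ.+ b ℤ.* b

V : ℤ[i] → ℕ → ℤ[i]
V k zero = ι 1ℤ
V k (suc zero) = ι (+ 2) *ᵍ k -ᵍ ι 1ℤ
V k (suc (suc n)) = ι (+ 2) *ᵍ k *ᵍ V k (suc n) -ᵍ V k n

-- initial values W_0^{(j)}, W_1^{(j)} for j = 1..6 (Fin 6: zero ↦ j = 1, ...)
W₀ : ℤ[i] → Fin 6 → ℤ[i]
W₀ k zero = ι 1ℤ
W₀ k (suc zero) = ι 1ℤ
W₀ k (suc (suc zero)) = k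
W₀ k (suc (suc (suc zero))) = k
W₀ k (suc (suc (suc (suc zero)))) = ι (+ 2) *ᵍ k -ᵍ ι 1ℤ
W₀ k (suc (suc (suc (suc (suc zero))))) = ι (+ 2) *ᵍ k -ᵍ ι 1ℤ

W₁ : ℤ[i] → Fin 6 → ℤ[i]
W₁ k zero = ι (+ 4) *ᵍ k *ᵍ k -ᵍ k -ᵍ ι (+ 2)
W₁ k (suc zero) = ι (+ 4) *ᵍ k *ᵍ k -ᵍ ι (+ 3) *ᵍ k
W₁ k (suc (suc zero)) = ι (+ 8) *ᵍ k *ᵍ k *ᵍ k -ᵍ ι (+ 4) *ᵍ k *ᵍ k -ᵍ ι (+ 4) *ᵍ k +ᵍ ι 1ℤ
W₁ k (suc (suc (suc zero))) = ι (+ 2) *ᵍ k -ᵍ ι 1ℤ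
W₁ k (suc (suc (suc (suc zero)))) = ι (+ 16) *ᵍ k *ᵍ k *ᵍ k -ᵍ ι (+ 16) *ᵍ k *ᵍ k -ᵍ k +ᵍ ι (+ 2)
W₁ k (suc (suc (suc (suc (suc zero))))) = k

W : ℤ[i] → Fin 6 → ℕ → ℤ[i]
W k j zero = W₀ k j
W k j (suc zero) = W₁ k j
W k j (suc (suc m)) =
  ι (+ 2) *ᵍ (ι (+ 4) *ᵍ k *ᵍ k -ᵍ ι (+ 2) *ᵍ k -ᵍ ι 1ℤ) *ᵍ W k j (suc m) -ᵍ W k j m

module Submission where

-- Proof of Lemma 7.1.  Write N = |k|² (so N ≥ 7, because 4N > 25) and ‖x‖ = |x|² ∈ ℕ for x ∈ ℤ[i].  Square roots are unavailable, so all estimates are stated for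
-- squared norms, and the triangle inequality is replaced by its weighted forms
--     q|x+y|² ≤ (q+1)|x|² + q(q+1)|y|²,      p|x|² ≤ (p+1)|x+y|² + p(p+1)|y|²,
-- which follow from coordinate identities.
--
-- Module Estimates applies them
-- to V and W: with ρ = 8N + 2 and σ = (3N)³,
--     ‖V(n+1)‖ ≤ ρ‖V(n)‖,   ρ‖W(m+1)‖ ≤ ‖W(m+2)‖,   3N‖V(n+1)‖ ≤ ‖V(n+2)‖,   ‖W(m)‖ ≤ N³σᵐ.
-- The first two give ‖V(n)‖ < ‖W(m)‖ whenever n < m, the last two give ‖W(m)‖ < ‖V(n)‖ whenever
-- n > 3m + 2, and V(n) = ±W(m) forces equal norms.  The numerical side conditions are polynomial
-- inequalities in N ≥ 7 (module Polynomial), proved by writing N = t + 7 and exhibiting the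
-- difference as a polynomial in t with non-negative coefficients.

open import Defs
import Data.Nat as Nat
open Nat using (ℕ; zero; suc; _≤_; _<_; z≤n; s≤s; NonZero)
import Data.Nat.Properties as ℕP
open import Data.Nat.Tactic.RingSolver using (solve; solve-∀)
open import Data.Fin using (Fin; zero; suc)
open import Data.Integer as Int using (ℤ; +_; -[1+_]; 0ℤ; 1ℤ)
import Data.Integer.Properties as ℤP
import Data.Integer.Tactic.RingSolver as ℤSolver
open import Data.List using (_∷_; [])
open import Data.Product using (_×_; _,_; proj₁)
open import Data.Sum using (_⊎_; inj₁; inj₂)
open import Relation.Binary.PropositionalEquality

module Coordinates where
  open Int using (_+_; _-_; _*_; -_)

  mul : ∀ a b c d → (a * c - b * d) * (a * c - b * d) + (a * d + b * c) * (a * d + b * c)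
                    ≡ (a * a + b * b) * (c * c + d * d)
  mul = ℤSolver.solve-∀

  neg : ∀ a b → (- a) * (- a) + (- b) * (- b) ≡ a * a + b * b
  neg = ℤSolver.solve-∀

  -- q|x+y|² + |x − qy|² = (1+q)|x|² + q(1+q)|y|²
  upper : ∀ q a b c d →
    q * ((a + c) * (a + c) + (b + d) * (b + d))
      + ((a - (q * c - 0ℤ * d)) * (a - (q * c - 0ℤ * d)) + (b - (q * d + 0ℤ * c)) * (b - (q * d + 0ℤ * c)))
    ≡ (1ℤ + q) * (a * a + b * b) + q * (1ℤ + q) * (c * c + d * d)
  upper = ℤSolver.solve-∀

  -- p|x|² + |x + (1+p)y|² = (1+p)|x+y|² + p(1+p)|y|²
  lower : ∀ p a b c d →
    p * (a * a + b * b)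
      + ((a + ((1ℤ + p) * c - 0ℤ * d)) * (a + ((1ℤ + p) * c - 0ℤ * d))
         + (b + ((1ℤ + p) * d + 0ℤ * c)) * (b + ((1ℤ + p) * d + 0ℤ * c)))
    ≡ (1ℤ + p) * ((a + c) * (a + c) + (b + d) * (b + d)) + p * (1ℤ + p) * (c * c + d * d)
  lower = ℤSolver.solve-∀

open Nat using (_+_; _*_; _^_)
open ℕP using (≤-refl; ≤-reflexive; ≤-trans; +-mono-≤; +-monoˡ-≤; +-monoʳ-≤; *-monoˡ-≤; *-monoʳ-≤)

‖_‖ : ℤ[i] → ℕ
‖ x ‖ = Int.∣ normSq x ∣

square-pos : ∀ a → a Int.* a ≡ + (Int.∣ a ∣ * Int.∣ a ∣)
square-pos (+ n) = sym (ℤP.pos-* n n)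
square-pos -[1+ n ] = refl

normSq≡‖‖ : ∀ x → normSq x ≡ + ‖ x ‖
normSq≡‖‖ (a + b i) = sym (ℤP.0≤i⇒+∣i∣≡i (subst (0ℤ Int.≤_) (sym squares) (Int.+≤+ z≤n)))
  where
  squares : a Int.* a Int.+ b Int.* b ≡ + (Int.∣ a ∣ * Int.∣ a ∣ + Int.∣ b ∣ * Int.∣ b ∣)
  squares = cong₂ Int._+_ (square-pos a) (square-pos b)

‖*‖ : ∀ x y → ‖ x *ᵍ y ‖ ≡ ‖ x ‖ * ‖ y ‖
‖*‖ (a + b i) (c + d i) =
  trans (cong Int.∣_∣ (Coordinates.mul a b c d)) (ℤP.abs-* (normSq (a + b i)) (normSq (c + d i)))

‖-‖ : ∀ x → ‖ -ᵍ x ‖ ≡ ‖ x ‖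
‖-‖ (a + b i) = cong Int.∣_∣ (Coordinates.neg a b)

‖ι‖ : ∀ c → ‖ ι (+ c) ‖ ≡ c * c
‖ι‖ c = trans (cong (λ z → Int.∣ z Int.+ 0ℤ ∣) (square-pos (+ c))) (ℕP.+-identityʳ (c * c))

excess : ∀ {a b} e → a + e ≡ b → a ≤ b
excess {a} e refl = ℕP.m≤m+n a e

cast : ∀ a x z b y c w →
       + a Int.* normSq x Int.+ normSq z ≡ + b Int.* normSq y Int.+ + c Int.* normSq w →
       a * ‖ x ‖ + ‖ z ‖ ≡ b * ‖ y ‖ + c * ‖ w ‖
cast a x z b y c w eq = ℤP.+-injective (begin
  + (a * ‖ x ‖ + ‖ z ‖)                         ≡⟨ ℤP.pos-+ (a * ‖ x ‖) ‖ z ‖ ⟩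
  + (a * ‖ x ‖) Int.+ + ‖ z ‖                   ≡⟨ cong (Int._+ + ‖ z ‖) (ℤP.pos-* a ‖ x ‖) ⟩
  + a Int.* + ‖ x ‖ Int.+ + ‖ z ‖               ≡⟨ cong₂ (λ u v → + a Int.* u Int.+ v) (normSq≡‖‖ x) (normSq≡‖‖ z) ⟨
  + a Int.* normSq x Int.+ normSq z             ≡⟨ eq ⟩
  + b Int.* normSq y Int.+ + c Int.* normSq w   ≡⟨ cong₂ (λ u v → + b Int.* u Int.+ + c Int.* v) (normSq≡‖‖ y) (normSq≡‖‖ w) ⟩
  + b Int.* + ‖ y ‖ Int.+ + c Int.* + ‖ w ‖     ≡⟨ cong₂ Int._+_ (ℤP.pos-* b ‖ y ‖) (ℤP.pos-* c ‖ w ‖) ⟨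
  + (b * ‖ y ‖) Int.+ + (c * ‖ w ‖)             ≡⟨ ℤP.pos-+ (b * ‖ y ‖) (c * ‖ w ‖) ⟨
  + (b * ‖ y ‖ + c * ‖ w ‖)                     ∎)
  where open ≡-Reasoning

-- Weighted triangle inequality |x + y|² ≤ (1 + 1/q)|x|² + (1 + q)|y|²: drop |x − qy|² ≥ 0.
norm-add-upper : ∀ q x y → q * ‖ x +ᵍ y ‖ ≤ suc q * ‖ x ‖ + q * suc q * ‖ y ‖
norm-add-upper q x@(a + b i) y@(c + d i) =
  excess ‖ x -ᵍ ι (+ q) *ᵍ y ‖ (cast q (x +ᵍ y) (x -ᵍ ι (+ q) *ᵍ y) (suc q) x (q * suc q) y
    (trans (Coordinates.upper (+ q) a b c d)
           (cong (λ z → + suc q Int.* normSq x Int.+ z Int.* normSq y) (sym (ℤP.pos-* q (suc q))))))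

-- Weighted triangle inequality (1 − 1/(1+p))|x|² ≤ |x + y|² + p|y|²: drop |x + (1+p)y|² ≥ 0.
norm-add-lower : ∀ p x y → p * ‖ x ‖ ≤ suc p * ‖ x +ᵍ y ‖ + p * suc p * ‖ y ‖
norm-add-lower p x@(a + b i) y@(c + d i) =
  excess ‖ x +ᵍ ι (+ suc p) *ᵍ y ‖ (cast p x (x +ᵍ ι (+ suc p) *ᵍ y) (suc p) (x +ᵍ y) (p * suc p) y
    (trans (Coordinates.lower (+ p) a b c d)
           (cong (λ z → + suc p Int.* normSq (x +ᵍ y) Int.+ z Int.* normSq y) (sym (ℤP.pos-* p (suc p))))))

norm-sub-upper : ∀ q x y → q * ‖ x -ᵍ y ‖ ≤ suc q * ‖ x ‖ + q * suc q * ‖ y ‖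
norm-sub-upper q x y = subst (λ w → q * ‖ x -ᵍ y ‖ ≤ suc q * ‖ x ‖ + q * suc q * w) (‖-‖ y) (norm-add-upper q x (-ᵍ y))

norm-sub-lower : ∀ p x y → p * ‖ x ‖ ≤ suc p * ‖ x -ᵍ y ‖ + p * suc p * ‖ y ‖
norm-sub-lower p x y = subst (λ w → p * ‖ x ‖ ≤ suc p * ‖ x -ᵍ y ‖ + p * suc p * w) (‖-‖ y) (norm-add-lower p x (-ᵍ y))

norm-add≤ : ∀ x y → ‖ x +ᵍ y ‖ ≤ 2 * ‖ x ‖ + 2 * ‖ y ‖
norm-add≤ x y = subst (_≤ 2 * ‖ x ‖ + 2 * ‖ y ‖) (ℕP.*-identityˡ _) (norm-add-upper 1 x y)

norm-sub≤ : ∀ x y → ‖ x -ᵍ y ‖ ≤ 2 * ‖ x ‖ + 2 * ‖ y ‖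
norm-sub≤ x y = subst (_≤ 2 * ‖ x ‖ + 2 * ‖ y ‖) (ℕP.*-identityˡ _) (norm-sub-upper 1 x y)

norm≤-add : ∀ x y → ‖ x ‖ ≤ 2 * ‖ x +ᵍ y ‖ + 2 * ‖ y ‖
norm≤-add x y = subst (_≤ 2 * ‖ x +ᵍ y ‖ + 2 * ‖ y ‖) (ℕP.*-identityˡ _) (norm-add-lower 1 x y)

norm≤-sub : ∀ x y → ‖ x ‖ ≤ 2 * ‖ x -ᵍ y ‖ + 2 * ‖ y ‖
norm≤-sub x y = subst (_≤ 2 * ‖ x -ᵍ y ‖ + 2 * ‖ y ‖) (ℕP.*-identityˡ _) (norm-sub-lower 1 x y)

add≤ : ∀ x y {X Y} → ‖ x ‖ ≤ X → ‖ y ‖ ≤ Y → ‖ x +ᵍ y ‖ ≤ 2 * X + 2 * Y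
add≤ x y x≤ y≤ = ≤-trans (norm-add≤ x y) (+-mono-≤ (*-monoʳ-≤ 2 x≤) (*-monoʳ-≤ 2 y≤))

sub≤ : ∀ x y {X Y} → ‖ x ‖ ≤ X → ‖ y ‖ ≤ Y → ‖ x -ᵍ y ‖ ≤ 2 * X + 2 * Y
sub≤ x y x≤ y≤ = ≤-trans (norm-sub≤ x y) (+-mono-≤ (*-monoʳ-≤ 2 x≤) (*-monoʳ-≤ 2 y≤))

sub≤[_] : ∀ q x y {X Y B} .{{_ : NonZero q}} → ‖ x ‖ ≤ X → ‖ y ‖ ≤ Y →
          suc q * X + q * suc q * Y ≤ q * B → ‖ x -ᵍ y ‖ ≤ B
sub≤[ q ] x y x≤ y≤ total = ℕP.*-cancelˡ-≤ q
  (≤-trans (norm-sub-upper q x y) (≤-trans (+-mono-≤ (*-monoʳ-≤ (suc q) x≤) (*-monoʳ-≤ (q * suc q) y≤)) total))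

lead-sub : ∀ m y {M Y} → M ≤ ‖ m ‖ → ‖ y ‖ ≤ Y → M ≤ 2 * ‖ m -ᵍ y ‖ + 2 * Y
lead-sub m y M≤ y≤ = ≤-trans M≤ (≤-trans (norm≤-sub m y) (+-monoʳ-≤ (2 * ‖ m -ᵍ y ‖) (*-monoʳ-≤ 2 y≤)))

rescale : ∀ {P a X E Z Y} → P ≤ a * X + E → X ≤ 2 * Z + 2 * Y → P ≤ 2 * a * Z + (2 * a * Y + E)
rescale {P} {a} {X} {E} {Z} {Y} P≤ X≤ = begin
  P                        ≤⟨ P≤ ⟩
  a * X + E                ≤⟨ +-monoˡ-≤ E (*-monoʳ-≤ a X≤) ⟩
  a * (2 * Z + 2 * Y) + E  ≡⟨ regroup a Z Y E ⟩
  2 * a * Z + (2 * a * Y + E) ∎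
  where
  open ℕP.≤-Reasoning
  regroup : ∀ a Z Y E → a * (2 * Z + 2 * Y) + E ≡ 2 * a * Z + (2 * a * Y + E)
  regroup = solve-∀

lead-add : ∀ m y {M Y} → M ≤ ‖ m ‖ → ‖ y ‖ ≤ Y → M ≤ 2 * ‖ m +ᵍ y ‖ + 2 * Y
lead-add m y M≤ y≤ = ≤-trans M≤ (≤-trans (norm≤-add m y) (+-monoʳ-≤ (2 * ‖ m +ᵍ y ‖) (*-monoʳ-≤ 2 y≤)))

then-sub : ∀ x y {P a E Y} → P ≤ a * ‖ x ‖ + E → ‖ y ‖ ≤ Y → P ≤ 2 * a * ‖ x -ᵍ y ‖ + (2 * a * Y + E)
then-sub x y {a = a} {E} P≤ y≤ = rescale {a = a} {E = E} P≤ (lead-sub x y ≤-refl y≤)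

then-add : ∀ x y {P a E Y} → P ≤ a * ‖ x ‖ + E → ‖ y ‖ ≤ Y → P ≤ 2 * a * ‖ x +ᵍ y ‖ + (2 * a * Y + E)
then-add x y {a = a} {E} P≤ y≤ = rescale {a = a} {E = E} P≤ (lead-add x y ≤-refl y≤)

cancel-sum : ∀ {x y E P} → x + E ≤ P → P ≤ y + E → x ≤ y
cancel-sum {x} {y} {E} lower upper = ℕP.+-cancelʳ-≤ E x y (≤-trans lower upper)

cancel-affine : ∀ a {x y E P} .{{_ : NonZero a}} → a * x + E ≤ P → P ≤ a * y + E → x ≤ y
cancel-affine a lower upper = ℕP.*-cancelˡ-≤ a (cancel-sum lower upper)

Recurrence : ℤ[i] → (ℕ → ℤ[i]) → Set
Recurrence c X = ∀ n → X (suc (suc n)) ≡ c *ᵍ X (suc n) -ᵍ X n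

growth-arith : ∀ p r t s K A B Z .{{_ : NonZero r}} →
  suc p * s * r + p * suc p * t ≤ p * r * K → r * B ≤ t * A →
  p * (K * A) ≤ suc p * Z + p * suc p * B → s * A ≤ Z
growth-arith p r t s K A B Z cond rB≤tA triangle =
  ℕP.*-cancelˡ-≤ r (ℕP.*-cancelˡ-≤ (suc p) (ℕP.+-cancelʳ-≤ (p * suc p * (t * A)) _ _ (begin
    suc p * (r * (s * A)) + p * suc p * (t * A) ≡⟨ regroup₁ p r t s A ⟩
    (suc p * s * r + p * suc p * t) * A         ≤⟨ *-monoˡ-≤ A cond ⟩
    p * r * K * A                               ≡⟨ regroup₂ p r K A ⟩
    r * (p * (K * A))                           ≤⟨ *-monoʳ-≤ r triangle ⟩
    r * (suc p * Z + p * suc p * B)             ≡⟨ regroup₃ p r Z B ⟩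
    suc p * (r * Z) + p * suc p * (r * B)       ≤⟨ +-monoʳ-≤ (suc p * (r * Z)) (*-monoʳ-≤ (p * suc p) rB≤tA) ⟩
    suc p * (r * Z) + p * suc p * (t * A)       ∎)))
  where
  open ℕP.≤-Reasoning
  regroup₁ : ∀ p r t s A → suc p * (r * (s * A)) + p * suc p * (t * A) ≡ (suc p * s * r + p * suc p * t) * A
  regroup₁ = solve-∀
  regroup₂ : ∀ p r K A → p * r * K * A ≡ r * (p * (K * A))
  regroup₂ = solve-∀
  regroup₃ : ∀ p r Z B → r * (suc p * Z + p * suc p * B) ≡ suc p * (r * Z) + p * suc p * (r * B)
  regroup₃ = solve-∀

growth-step : ∀ {c a b} p r t s K .{{_ : NonZero r}} →
  suc p * s * r + p * suc p * t ≤ p * r * K → K ≤ ‖ c ‖ →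
  r * ‖ b ‖ ≤ t * ‖ a ‖ → s * ‖ a ‖ ≤ ‖ c *ᵍ a -ᵍ b ‖
growth-step {c} {a} {b} p r t s K cond K≤ rB≤tA = growth-arith p r t s K (‖ a ‖) (‖ b ‖) (‖ c *ᵍ a -ᵍ b ‖) cond rB≤tA
  (≤-trans (*-monoʳ-≤ p (≤-trans (*-monoˡ-≤ (‖ a ‖) K≤) (≤-reflexive (sym (‖*‖ c a)))))
           (norm-sub-lower p (c *ᵍ a) b))

module Growth {c X} (rec : Recurrence c X) (p r t s K : ℕ) .{{_ : NonZero r}}
              (cond : suc p * s * r + p * suc p * t ≤ p * r * K) (K≤ : K ≤ ‖ c ‖) (r≤ts : r ≤ t * s)
              (base : r * ‖ X 0 ‖ ≤ t * ‖ X 1 ‖) where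

  -- The ratio bound r‖X(n)‖ ≤ t‖X(n+1)‖ yields the stronger s‖X(n+1)‖ ≤ ‖X(n+2)‖ ...
  next : ∀ n → r * ‖ X n ‖ ≤ t * ‖ X (suc n) ‖ → s * ‖ X (suc n) ‖ ≤ ‖ X (suc (suc n)) ‖
  next n hyp = subst (λ z → s * ‖ X (suc n) ‖ ≤ ‖ z ‖) (sym (rec n)) (growth-step {c} {X (suc n)} {X n} p r t s K cond K≤ hyp)

  -- ... which implies the ratio bound again (as r ≤ ts), so it holds for every n.
  invariant : ∀ n → r * ‖ X n ‖ ≤ t * ‖ X (suc n) ‖
  invariant zero = base
  invariant (suc n) = begin
    r * ‖ X (suc n) ‖       ≤⟨ *-monoˡ-≤ (‖ X (suc n) ‖) r≤ts ⟩
    t * s * ‖ X (suc n) ‖   ≡⟨ ℕP.*-assoc t s (‖ X (suc n) ‖) ⟩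
    t * (s * ‖ X (suc n) ‖) ≤⟨ *-monoʳ-≤ t (next n (invariant n)) ⟩
    t * ‖ X (suc (suc n)) ‖ ∎
    where open ℕP.≤-Reasoning

  ratio : ∀ n → s * ‖ X (suc n) ‖ ≤ ‖ X (suc (suc n)) ‖
  ratio n = next n (invariant n)

ratio-upper : ∀ {c X} K → Recurrence c X → ‖ c ‖ ≤ K → (∀ n → ‖ X n ‖ ≤ ‖ X (suc n) ‖) →
  ‖ X 1 ‖ ≤ (2 + 2 * K) * ‖ X 0 ‖ → ∀ n → ‖ X (suc n) ‖ ≤ (2 + 2 * K) * ‖ X n ‖
ratio-upper K rec c≤ mono base zero = base
ratio-upper {c} {X} K rec c≤ mono base (suc n) = begin
  ‖ X (suc (suc n)) ‖                                  ≡⟨ cong ‖_‖ (rec n) ⟩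
  ‖ c *ᵍ X (suc n) -ᵍ X n ‖                            ≤⟨ sub≤ (c *ᵍ X (suc n)) (X n) (≤-reflexive (‖*‖ c (X (suc n)))) (mono n) ⟩
  2 * (‖ c ‖ * ‖ X (suc n) ‖) + 2 * ‖ X (suc n) ‖      ≤⟨ +-monoˡ-≤ (2 * ‖ X (suc n) ‖) (*-monoʳ-≤ 2 (*-monoˡ-≤ (‖ X (suc n) ‖) c≤)) ⟩
  2 * (K * ‖ X (suc n) ‖) + 2 * ‖ X (suc n) ‖          ≡⟨ regroup K (‖ X (suc n) ‖) ⟩
  (2 + 2 * K) * ‖ X (suc n) ‖                          ∎
  where
  open ℕP.≤-Reasoning
  regroup : ∀ K A → 2 * (K * A) + 2 * A ≡ (2 + 2 * K) * A
  regroup = solve-∀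

envelope-arith : ∀ q K σ U A B Z .{{_ : NonZero q}} →
  suc q * K * σ + q * suc q ≤ q * σ * σ → A ≤ σ * U → B ≤ U →
  q * Z ≤ suc q * (K * A) + q * suc q * B → Z ≤ σ * (σ * U)
envelope-arith q K σ U A B Z cond A≤ B≤ triangle = ℕP.*-cancelˡ-≤ q (begin
  q * Z                                        ≤⟨ triangle ⟩
  suc q * (K * A) + q * suc q * B              ≤⟨ +-mono-≤ (*-monoʳ-≤ (suc q) (*-monoʳ-≤ K A≤)) (*-monoʳ-≤ (q * suc q) B≤) ⟩
  suc q * (K * (σ * U)) + q * suc q * U        ≡⟨ regroup₁ q K σ U ⟩
  (suc q * K * σ + q * suc q) * U              ≤⟨ *-monoˡ-≤ U cond ⟩
  q * σ * σ * U                                ≡⟨ regroup₂ q σ U ⟩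
  q * (σ * (σ * U))                            ∎)
  where
  open ℕP.≤-Reasoning
  regroup₁ : ∀ q K σ U → suc q * (K * (σ * U)) + q * suc q * U ≡ (suc q * K * σ + q * suc q) * U
  regroup₁ = solve-∀
  regroup₂ : ∀ q σ U → q * σ * σ * U ≡ q * (σ * (σ * U))
  regroup₂ = solve-∀

envelope : ∀ {c X} q K σ C .{{_ : NonZero q}} → Recurrence c X → ‖ c ‖ ≤ K →
  suc q * K * σ + q * suc q ≤ q * σ * σ → ‖ X 0 ‖ ≤ C → ‖ X 1 ‖ ≤ C * σ → ∀ m → ‖ X m ‖ ≤ C * σ ^ m
envelope {c} {X} q K σ C rec c≤ cond X₀≤ X₁≤ m = proj₁ (consecutive m)
  where
  open ℕP.≤-Reasoning
  swap : ∀ C σ P → C * (σ * P) ≡ σ * (C * P)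
  swap = solve-∀
  rotate : ∀ C σ P → σ * (σ * (C * P)) ≡ C * (σ * (σ * P))
  rotate = solve-∀
  triangle : ∀ m → q * ‖ c *ᵍ X (suc m) -ᵍ X m ‖ ≤ suc q * (K * ‖ X (suc m) ‖) + q * suc q * ‖ X m ‖
  triangle m = ≤-trans (norm-sub-upper q (c *ᵍ X (suc m)) (X m))
    (+-monoˡ-≤ (q * suc q * (‖ X m ‖)) (*-monoʳ-≤ (suc q)
      (≤-trans (≤-reflexive (‖*‖ c (X (suc m)))) (*-monoˡ-≤ (‖ X (suc m) ‖) c≤))))
  step : ∀ m → ‖ X (suc m) ‖ ≤ C * σ ^ suc m → ‖ X m ‖ ≤ C * σ ^ m →
         ‖ X (suc (suc m)) ‖ ≤ C * σ ^ suc (suc m)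
  step m a≤ b≤ = begin
    ‖ X (suc (suc m)) ‖        ≡⟨ cong ‖_‖ (rec m) ⟩
    ‖ c *ᵍ X (suc m) -ᵍ X m ‖  ≤⟨ envelope-arith q K σ (C * σ ^ m) _ _ _ cond
                                   (≤-trans a≤ (≤-reflexive (swap C σ (σ ^ m)))) b≤ (triangle m) ⟩
    σ * (σ * (C * σ ^ m))      ≡⟨ rotate C σ (σ ^ m) ⟩
    C * σ ^ suc (suc m)        ∎
  consecutive : ∀ m → ‖ X m ‖ ≤ C * σ ^ m × ‖ X (suc m) ‖ ≤ C * σ ^ suc m
  consecutive zero =
    ≤-trans X₀≤ (≤-reflexive (sym (ℕP.*-identityʳ C))) ,
    ≤-trans X₁≤ (≤-reflexive (cong (C *_) (sym (ℕP.*-identityʳ σ))))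
  consecutive (suc m) with consecutive m
  ... | b≤ , a≤ = a≤ , step m a≤ b≤

ratio-power : ∀ {f : ℕ → ℕ} s → (∀ n → s * f n ≤ f (suc n)) → ∀ j n → s ^ j * f n ≤ f (j + n)
ratio-power {f} s grows zero n = ≤-reflexive (ℕP.*-identityˡ (f n))
ratio-power {f} s grows (suc j) n = begin
  s * s ^ j * f n   ≡⟨ ℕP.*-assoc s (s ^ j) (f n) ⟩
  s * (s ^ j * f n) ≤⟨ *-monoʳ-≤ s (ratio-power s grows j n) ⟩
  s * f (j + n)     ≤⟨ grows (j + n) ⟩
  f (suc j + n)     ∎
  where open ℕP.≤-Reasoning

monotone : ∀ {f : ℕ → ℕ} → (∀ n → f n ≤ f (suc n)) → ∀ {m n} → m ≤ n → f m ≤ f n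
monotone {f} step {m} {n} m≤n = subst (λ z → f m ≤ f z) (ℕP.m∸n+n≡m m≤n) (after (n Nat.∸ m))
  where
  after : ∀ d → f m ≤ f (d + m)
  after zero = ≤-refl
  after (suc d) = ≤-trans (after d) (step (d + m))

dominate : ∀ {x y : ℕ → ℕ} ρ .{{_ : NonZero ρ}} → y 0 < x 0 →
  (∀ m → ρ * x m ≤ x (suc m)) → (∀ m → y (suc m) ≤ ρ * y m) → ∀ m → y m < x m
dominate ρ y₀<x₀ x-grows y-slow zero = y₀<x₀
dominate ρ y₀<x₀ x-grows y-slow (suc m) =
  ℕP.≤-<-trans (y-slow m) (ℕP.<-≤-trans (ℕP.*-monoʳ-< ρ (dominate ρ y₀<x₀ x-grows y-slow m)) (x-grows m))

-- Polynomial inequalities for N = t + 7, each witnessed by its excess, a polynomial in t with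
-- non-negative coefficients.  Here ρ = 2 + 2·(4N) = 8N + 2, and σ = (3N)³ is written as a product.
-- The shapes of both sides are those produced by the estimates that use them.

module Polynomial where
  -- 2N + 2 ≤ 4N, so that 4N ≤ 2‖V(1)‖ + 2 gives N ≤ ‖V(1)‖
  V₁-lower : ∀ t → let N = t + 7 in 2 * N + 2 * 1 ≤ 2 * 2 * N
  V₁-lower t = excess (t * 2 + 12) (solve (t ∷ []))

  -- the crude bound on ‖V(1)‖ is ρ·‖V(0)‖
  V₁-first : ∀ t → let N = t + 7 in 2 * (2 * 2 * N) + 2 * 1 ≤ (2 + 2 * (2 * 2 * N)) * 1
  V₁-first t = ≤-reflexive (solve (t ∷ []))

  -- growth condition for V (weight 8, ratio N in, ratio 3N out, ‖2k‖ = 4N)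
  V-growth : ∀ t → let N = t + 7 in 8 * (3 * N) * N + 7 * 8 * 1 ≤ 7 * N * (2 * 2 * N)
  V-growth t = excess (t * (t * 4 + 56) + 140) (solve (t ∷ []))

  -- the ratio 3N implies the ratio N
  V-ratios : ∀ t → let N = t + 7 in N ≤ 1 * (3 * N)
  V-ratios t = excess (t * 2 + 14) (solve (t ∷ []))

  -- ‖2(4k² − 2k − 1)‖ ≥ 16N + 22, given 16N² ≤ 4‖4k² − 2k − 1‖ + 4 + 8N
  c-lower : ∀ t → let N = t + 7 in 16 * N + 22 + (2 * 2 * 1 + 2 * (2 * 2 * N)) ≤ 4 * 4 * N * N
  c-lower t = excess (t * (t * 16 + 200) + 590) (solve (t ∷ []))

  -- growth condition for W (weight 2, ratio 1/9 in, ratio ρ out)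
  W-growth : ∀ t → let N = t + 7 in 2 * (2 + 2 * (2 * 2 * N)) * 1 + 1 * 2 * 9 ≤ 1 * 1 * (16 * N + 22)
  W-growth t = ≤-reflexive (solve (t ∷ []))

  -- ‖4k² − 2k‖ ≤ 20N² + 20N
  M-upper : ∀ t → let N = t + 7 in 5 * (4 * 4 * N * N) + 4 * 5 * (2 * 2 * N) ≤ 4 * (20 * N * N + 20 * N)
  M-upper t = ≤-reflexive (solve (t ∷ []))

  -- ‖4k² − 2k − 1‖ ≤ 25N² + 25N + 5
  L-upper : ∀ t → let N = t + 7 in 5 * (20 * N * N + 20 * N) + 4 * 5 * 1 ≤ 4 * (25 * N * N + 25 * N + 5)
  L-upper t = ≤-reflexive (solve (t ∷ []))

  -- envelope condition for W (weight 4, ‖c‖ ≤ 4(25N² + 25N + 5))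
  envelope-condition : ∀ t → let N = t + 7; σ = 3 * N * (3 * N * (3 * N * 1)) in 5 * (4 * (25 * N * N + 25 * N + 5)) * σ + 4 * 5 ≤ 4 * σ * σ
  envelope-condition t = excess (t * (t * (t * (t * (t * (t * 2916 + 108972) + 1657260) + 13008060) + 54689040) + 113068872) + 82830364) (solve (t ∷ []))

  -- ‖W(0)‖ ≤ 9N, for W(0) ∈ {1, k, 2k − 1}
  W₀-one : ∀ t → let N = t + 7 in 1 ≤ 9 * N
  W₀-one t = excess (t * 9 + 62) (solve (t ∷ []))

  W₀-k : ∀ t → let N = t + 7 in N ≤ 9 * N
  W₀-k t = excess (t * 8 + 56) (solve (t ∷ []))

  W₀-V₁ : ∀ t → let N = t + 7 in 2 * (2 * 2 * N) + 2 * 1 ≤ 9 * N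
  W₀-V₁ t = excess (t + 5) (solve (t ∷ []))

  W₀-envelope : ∀ t → let N = t + 7 in 9 * N ≤ N * N * N
  W₀-envelope t = excess (t * (t * (t + 21) + 138) + 280) (solve (t ∷ []))

  -- N ≤ ‖W(1)‖ for j = 1, 2, 3, 5
  W₁-lower₁ : ∀ t → let N = t + 7 in 4 * N + (2 * 2 * 4 + 2 * N) ≤ 4 * 4 * N * N
  W₁-lower₁ t = excess (t * (t * 16 + 218) + 726) (solve (t ∷ []))

  W₁-lower₂ : ∀ t → let N = t + 7 in 2 * N + 2 * (3 * 3 * N) ≤ 4 * 4 * N * N
  W₁-lower₂ t = excess (t * (t * 16 + 204) + 644) (solve (t ∷ []))

  W₁-lower₃ : ∀ t → let N = t + 7 in 8 * N + (2 * (2 * 2) * 1 + (2 * 2 * (4 * 4 * N) + 2 * (4 * 4 * N * N))) ≤ 8 * 8 * N * N * N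
  W₁-lower₃ t = excess (t * (t * (t * 64 + 1312) + 8888) + 19872) (solve (t ∷ []))

  W₁-lower₅ : ∀ t → let N = t + 7 in 8 * N + (2 * (2 * 2) * 4 + (2 * 2 * N + 2 * (16 * 16 * N * N))) ≤ 16 * 16 * N * N * N
  W₁-lower₅ t = excess (t * (t * (t * 256 + 4864) + 30452) + 62604) (solve (t ∷ []))

  -- ‖W(1)‖ ≤ 4096N³ for j = 1, ..., 6
  W₁-upper₁ : ∀ t → let N = t + 7 in 2 * (2 * (4 * 4 * N * N) + 2 * N) + 2 * 4 ≤ N * N * N * 4096
  W₁-upper₁ t = excess (t * (t * (t * 4096 + 85952) + 601212) + 1401756) (solve (t ∷ []))

  W₁-upper₂ : ∀ t → let N = t + 7 in 2 * (4 * 4 * N * N) + 2 * (3 * 3 * N) ≤ N * N * N * 4096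
  W₁-upper₂ t = excess (t * (t * (t * 4096 + 85984) + 601646) + 1403234) (solve (t ∷ []))

  W₁-upper₃ : ∀ t → let N = t + 7 in 2 * (2 * (2 * (8 * 8 * N * N * N) + 2 * (4 * 4 * N * N)) + 2 * (4 * 4 * N)) + 2 * 1 ≤ N * N * N * 4096
  W₁-upper₃ t = excess (t * (t * (t * 3584 + 75136) + 524992) + 1222590) (solve (t ∷ []))

  W₁-upper₄ : ∀ t → let N = t + 7 in 2 * (2 * 2 * N) + 2 * 1 ≤ N * N * N * 4096
  W₁-upper₄ t = excess (t * (t * (t * 4096 + 86016) + 602104) + 1404870) (solve (t ∷ []))

  W₁-upper₅ : ∀ t → let N = t + 7 in 2 * (2 * (2 * (16 * 16 * N * N * N) + 2 * (16 * 16 * N * N)) + 2 * N) + 2 * 4 ≤ N * N * N * 4096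
  W₁-upper₅ t = excess (t * (t * (t * 2048 + 40960) + 272380) + 602076) (solve (t ∷ []))

  W₁-upper₆ : ∀ t → let N = t + 7 in N ≤ N * N * N * 4096
  W₁-upper₆ t = excess (t * (t * (t * 4096 + 86016) + 602111) + 1404921) (solve (t ∷ []))

  W₁-envelope : ∀ t → let N = t + 7; σ = 3 * N * (3 * N * (3 * N * 1)) in N * N * N * 4096 ≤ N * N * N * σ
  W₁-envelope t = excess (t * (t * (t * (t * (t * (t * 27 + 1134) + 19845) + 181124) + 886389) + 2120622) + 1771595) (solve (t ∷ []))

  separation : ∀ t → let N = t + 7 in suc (N * N * N) ≤ 3 * N * (3 * N * 1) * N
  separation t = excess (t * (t * (t * 8 + 168) + 1176) + 2743) (solve (t ∷ []))

module Estimates (k : ℤ[i]) (t : ℕ) (‖k‖≡N : ‖ k ‖ ≡ t + 7) where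
  module P = Polynomial

  N ρ σ : ℕ
  N = t + 7
  ρ = 2 + 2 * (2 * 2 * N)
  σ = (3 * N) ^ 3

  7≤N : 7 ≤ N
  7≤N = ℕP.m≤n+m 7 t

  instance
    N-nonZero : NonZero N
    N-nonZero = Nat.>-nonZero (≤-trans (s≤s z≤n) 7≤N)

  k¹ : ∀ c → ‖ ι (+ c) *ᵍ k ‖ ≡ c * c * N
  k¹ c = trans (‖*‖ (ι (+ c)) k) (cong₂ _*_ (‖ι‖ c) ‖k‖≡N)

  k² : ∀ c → ‖ ι (+ c) *ᵍ k *ᵍ k ‖ ≡ c * c * N * N
  k² c = trans (‖*‖ (ι (+ c) *ᵍ k) k) (cong₂ _*_ (k¹ c) ‖k‖≡N)

  k³ : ∀ c → ‖ ι (+ c) *ᵍ k *ᵍ k *ᵍ k ‖ ≡ c * c * N * N * N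
  k³ c = trans (‖*‖ (ι (+ c) *ᵍ k *ᵍ k) k) (cong₂ _*_ (k² c) ‖k‖≡N)

  V-rec : Recurrence (ι (+ 2) *ᵍ k) (V k)
  V-rec n = refl

  V₁-upper : ‖ V k 1 ‖ ≤ 2 * (2 * 2 * N) + 2 * 1
  V₁-upper = sub≤ (ι (+ 2) *ᵍ k) (ι 1ℤ) (≤-reflexive (k¹ 2)) ≤-refl

  V₁-lower : N ≤ ‖ V k 1 ‖
  V₁-lower = cancel-affine 2 (P.V₁-lower t) (lead-sub (ι (+ 2) *ᵍ k) (ι 1ℤ) (≤-reflexive (sym (k¹ 2))) ≤-refl)

  module V-growth = Growth {ι (+ 2) *ᵍ k} {V k} V-rec 7 N 1 (3 * N) (2 * 2 * N) (P.V-growth t) (≤-reflexive (sym (k¹ 2))) (P.V-ratios t)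
    (subst₂ _≤_ (sym (ℕP.*-identityʳ N)) (sym (ℕP.*-identityˡ (‖ V k 1 ‖))) V₁-lower)

  V-step : ∀ n → ‖ V k n ‖ ≤ ‖ V k (suc n) ‖
  V-step n = ≤-trans (ℕP.m≤n*m (‖ V k n ‖) N)
                     (≤-trans (V-growth.invariant n) (≤-reflexive (ℕP.*-identityˡ (‖ V k (suc n) ‖))))

  V-mono : ∀ {m n} → m ≤ n → ‖ V k m ‖ ≤ ‖ V k n ‖
  V-mono = monotone {λ n → ‖ V k n ‖} V-step

  V-slow : ∀ n → ‖ V k (suc n) ‖ ≤ ρ * ‖ V k n ‖
  V-slow = ratio-upper {ι (+ 2) *ᵍ k} {V k} (2 * 2 * N) V-rec (≤-reflexive (k¹ 2)) V-step (≤-trans V₁-upper (P.V₁-first t))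

  V-power : ∀ m → (3 * N) ^ (3 * m + 2) * N ≤ ‖ V k (suc (3 * m + 2)) ‖
  V-power m = begin
    (3 * N) ^ (3 * m + 2) * N                 ≤⟨ *-monoʳ-≤ ((3 * N) ^ (3 * m + 2)) V₁-lower ⟩
    (3 * N) ^ (3 * m + 2) * ‖ V k 1 ‖         ≤⟨ ratio-power {λ n → ‖ V k (suc n) ‖} (3 * N) V-growth.ratio (3 * m + 2) 0 ⟩
    ‖ V k (suc (3 * m + 2 + 0)) ‖             ≡⟨ cong (λ i → ‖ V k (suc i) ‖) (ℕP.+-identityʳ (3 * m + 2)) ⟩
    ‖ V k (suc (3 * m + 2)) ‖                 ∎
    where open ℕP.≤-Reasoning

  -- σᵐ = (3N)^(3m), which puts the two exponential bounds on a common scale.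
  powers : ∀ m → (3 * N) ^ 2 * N * σ ^ m ≡ (3 * N) ^ (3 * m + 2) * N
  powers m = begin
    (3 * N) ^ 2 * N * σ ^ m                     ≡⟨ cong ((3 * N) ^ 2 * N *_) (ℕP.^-*-assoc (3 * N) 3 m) ⟩
    (3 * N) ^ 2 * N * (3 * N) ^ (3 * m)         ≡⟨ reorder ((3 * N) ^ 2) N ((3 * N) ^ (3 * m)) ⟩
    (3 * N) ^ (3 * m) * (3 * N) ^ 2 * N         ≡⟨ cong (_* N) (ℕP.^-distribˡ-+-* (3 * N) (3 * m) 2) ⟨
    (3 * N) ^ (3 * m + 2) * N                   ∎
    where
    open ≡-Reasoning
    reorder : ∀ a b c → a * b * c ≡ c * a * b
    reorder = solve-∀

  M L c : ℤ[i]
  M = ι (+ 4) *ᵍ k *ᵍ k -ᵍ ι (+ 2) *ᵍ k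
  L = M -ᵍ ι 1ℤ
  c = ι (+ 2) *ᵍ L

  W-rec : ∀ j → Recurrence c (W k j)
  W-rec j n = refl

  c-lower : 16 * N + 22 ≤ ‖ c ‖
  c-lower = cancel-sum (P.c-lower t)
    (≤-trans (then-sub M (ι 1ℤ) {a = 2} (lead-sub (ι (+ 4) *ᵍ k *ᵍ k) (ι (+ 2) *ᵍ k) (≤-reflexive (sym (k² 4))) (≤-reflexive (k¹ 2))) ≤-refl)
             (+-monoˡ-≤ _ (≤-reflexive (sym (‖*‖ (ι (+ 2)) L)))))

  c-upper : ‖ c ‖ ≤ 4 * (25 * N * N + 25 * N + 5)
  c-upper = ≤-trans (≤-reflexive (‖*‖ (ι (+ 2)) L)) (*-monoʳ-≤ 4 L-upper)
    where
    M-upper : ‖ M ‖ ≤ 20 * N * N + 20 * N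
    M-upper = sub≤[ 4 ] (ι (+ 4) *ᵍ k *ᵍ k) (ι (+ 2) *ᵍ k) (≤-reflexive (k² 4)) (≤-reflexive (k¹ 2)) (P.M-upper t)
    L-upper : ‖ L ‖ ≤ 25 * N * N + 25 * N + 5
    L-upper = sub≤[ 4 ] M (ι 1ℤ) M-upper ≤-refl (P.L-upper t)

  -- Bounds on the initial values: ‖W(0)‖ ≤ 9N, and N ≤ ‖W(1)‖ ≤ 4096N³ (the leading monomial
  -- 4k², 8k³ or 16k³ of W(1) dominates the rest).
  W₀-upper : ∀ j → ‖ W₀ k j ‖ ≤ 9 * N
  W₀-upper zero = P.W₀-one t
  W₀-upper (suc zero) = P.W₀-one t
  W₀-upper (suc (suc zero)) = ≤-trans (≤-reflexive ‖k‖≡N) (P.W₀-k t)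
  W₀-upper (suc (suc (suc zero))) = ≤-trans (≤-reflexive ‖k‖≡N) (P.W₀-k t)
  W₀-upper (suc (suc (suc (suc zero)))) = ≤-trans V₁-upper (P.W₀-V₁ t)
  W₀-upper (suc (suc (suc (suc (suc zero))))) = ≤-trans V₁-upper (P.W₀-V₁ t)

  W₁-lower : ∀ j → N ≤ ‖ W₁ k j ‖
  W₁-lower zero = cancel-affine 4 (P.W₁-lower₁ t)
    (then-sub (ι (+ 4) *ᵍ k *ᵍ k -ᵍ k) (ι (+ 2)) {a = 2}
      (lead-sub (ι (+ 4) *ᵍ k *ᵍ k) k (≤-reflexive (sym (k² 4))) (≤-reflexive ‖k‖≡N))
      ≤-refl)
  W₁-lower (suc zero) = cancel-affine 2 (P.W₁-lower₂ t)
    (lead-sub (ι (+ 4) *ᵍ k *ᵍ k) (ι (+ 3) *ᵍ k) (≤-reflexive (sym (k² 4))) (≤-reflexive (k¹ 3)))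
  W₁-lower (suc (suc zero)) = cancel-affine 8 (P.W₁-lower₃ t)
    (then-add (cubic -ᵍ ι (+ 4) *ᵍ k) (ι 1ℤ) {a = 4}
      (then-sub cubic (ι (+ 4) *ᵍ k) {a = 2}
        (lead-sub (ι (+ 8) *ᵍ k *ᵍ k *ᵍ k) (ι (+ 4) *ᵍ k *ᵍ k) (≤-reflexive (sym (k³ 8))) (≤-reflexive (k² 4)))
        (≤-reflexive (k¹ 4)))
      ≤-refl)
    where
    cubic : ℤ[i]
    cubic = ι (+ 8) *ᵍ k *ᵍ k *ᵍ k -ᵍ ι (+ 4) *ᵍ k *ᵍ k
  W₁-lower (suc (suc (suc zero))) = V₁-lower
  W₁-lower (suc (suc (suc (suc zero)))) = cancel-affine 8 (P.W₁-lower₅ t)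
    (then-add (cubic -ᵍ k) (ι (+ 2)) {a = 4}
      (then-sub cubic k {a = 2}
        (lead-sub (ι (+ 16) *ᵍ k *ᵍ k *ᵍ k) (ι (+ 16) *ᵍ k *ᵍ k) (≤-reflexive (sym (k³ 16))) (≤-reflexive (k² 16)))
        (≤-reflexive ‖k‖≡N))
      ≤-refl)
    where
    cubic : ℤ[i]
    cubic = ι (+ 16) *ᵍ k *ᵍ k *ᵍ k -ᵍ ι (+ 16) *ᵍ k *ᵍ k
  W₁-lower (suc (suc (suc (suc (suc zero))))) = ≤-reflexive (sym ‖k‖≡N)

  W₁-upper : ∀ j → ‖ W₁ k j ‖ ≤ N * N * N * 4096
  W₁-upper zero = ≤-trans
    (sub≤ (ι (+ 4) *ᵍ k *ᵍ k -ᵍ k) (ι (+ 2)) (sub≤ (ι (+ 4) *ᵍ k *ᵍ k) k (≤-reflexive (k² 4)) (≤-reflexive ‖k‖≡N)) ≤-refl)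
    (P.W₁-upper₁ t)
  W₁-upper (suc zero) = ≤-trans
    (sub≤ (ι (+ 4) *ᵍ k *ᵍ k) (ι (+ 3) *ᵍ k) (≤-reflexive (k² 4)) (≤-reflexive (k¹ 3)))
    (P.W₁-upper₂ t)
  W₁-upper (suc (suc zero)) = ≤-trans
    (add≤ (cubic -ᵍ ι (+ 4) *ᵍ k) (ι 1ℤ)
      (sub≤ cubic (ι (+ 4) *ᵍ k)
        (sub≤ (ι (+ 8) *ᵍ k *ᵍ k *ᵍ k) (ι (+ 4) *ᵍ k *ᵍ k) (≤-reflexive (k³ 8)) (≤-reflexive (k² 4)))
        (≤-reflexive (k¹ 4)))
      ≤-refl)
    (P.W₁-upper₃ t)
    where
    cubic : ℤ[i]
    cubic = ι (+ 8) *ᵍ k *ᵍ k *ᵍ k -ᵍ ι (+ 4) *ᵍ k *ᵍ k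
  W₁-upper (suc (suc (suc zero))) = ≤-trans V₁-upper (P.W₁-upper₄ t)
  W₁-upper (suc (suc (suc (suc zero)))) = ≤-trans
    (add≤ (cubic -ᵍ k) (ι (+ 2))
      (sub≤ cubic k
        (sub≤ (ι (+ 16) *ᵍ k *ᵍ k *ᵍ k) (ι (+ 16) *ᵍ k *ᵍ k) (≤-reflexive (k³ 16)) (≤-reflexive (k² 16)))
        (≤-reflexive ‖k‖≡N))
      ≤-refl)
    (P.W₁-upper₅ t)
    where
    cubic : ℤ[i]
    cubic = ι (+ 16) *ᵍ k *ᵍ k *ᵍ k -ᵍ ι (+ 16) *ᵍ k *ᵍ k
  W₁-upper (suc (suc (suc (suc (suc zero))))) = ≤-trans (≤-reflexive ‖k‖≡N) (P.W₁-upper₆ t)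

  W-first : ∀ j → 1 * ‖ W k j 0 ‖ ≤ 9 * ‖ W k j 1 ‖
  W-first j = ≤-trans (≤-reflexive (ℕP.*-identityˡ (‖ W₀ k j ‖))) (≤-trans (W₀-upper j) (*-monoʳ-≤ 9 (W₁-lower j)))

  W-fast : ∀ j m → ρ * ‖ W k j (suc m) ‖ ≤ ‖ W k j (suc (suc m)) ‖
  W-fast j = Growth.ratio {c} {W k j} (W-rec j) 1 1 9 ρ (16 * N + 22) (P.W-growth t) c-lower (s≤s z≤n) (W-first j)

  W-envelope : ∀ j m → ‖ W k j m ‖ ≤ N * N * N * σ ^ m
  W-envelope j = envelope {c} {W k j} 4 (4 * (25 * N * N + 25 * N + 5)) σ (N * N * N) (W-rec j) c-upper
    (P.envelope-condition t) (≤-trans (W₀-upper j) (P.W₀-envelope t)) (≤-trans (W₁-upper j) (P.W₁-envelope t))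

  -- If n < m then ‖V(n)‖ < ‖W(m)‖: W outgrows V from the start.
  W-beats-V : ∀ j {m n} → n < m → ‖ V k n ‖ < ‖ W k j m ‖
  W-beats-V j {suc m} (s≤s n≤m) = ℕP.≤-<-trans (V-mono n≤m)
    (dominate {λ m → ‖ W k j (suc m) ‖} {λ m → ‖ V k m ‖} ρ (≤-trans (s≤s (s≤s z≤n)) (≤-trans 7≤N (W₁-lower j)))
      (W-fast j) V-slow m)

  -- If 3m + 2 < n then ‖W(m)‖ < ‖V(n)‖: three steps of V outgrow one step of W.
  V-beats-W : ∀ j {m n} → 3 * m + 2 < n → ‖ W k j m ‖ < ‖ V k n ‖
  V-beats-W j {m} {n} 3m+2<n = begin-strict
    ‖ W k j m ‖                 ≤⟨ W-envelope j m ⟩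
    N * N * N * σ ^ m           <⟨ ℕP.*-monoˡ-< (σ ^ m) {{σᵐ≢0}} (P.separation t) ⟩
    (3 * N) ^ 2 * N * σ ^ m     ≡⟨ powers m ⟩
    (3 * N) ^ (3 * m + 2) * N   ≤⟨ V-power m ⟩
    ‖ V k (suc (3 * m + 2)) ‖   ≤⟨ V-mono 3m+2<n ⟩
    ‖ V k n ‖                   ∎
    where
    open ℕP.≤-Reasoning
    σᵐ≢0 : NonZero (σ ^ m)
    σᵐ≢0 = ℕP.m^n≢0 σ m {{ℕP.m^n≢0 (3 * N) 3 {{ℕP.m*n≢0 3 N}}}}

seven≤ : ∀ {N} → 25 < 4 * N → 7 ≤ N
seven≤ 25<4N = ℕP.≮⇒≥ λ N<7 → ℕP.<⇒≱ 25<4N (≤-trans (*-monoʳ-≤ 4 (ℕP.≤-pred N<7)) (ℕP.n≤1+n 24))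

norm-at-least-7 : ∀ k → + 25 Int.< + 4 Int.* normSq k → 7 ≤ ‖ k ‖
norm-at-least-7 k 25<4N = seven≤ (ℤP.drop‿+<+ (subst (+ 25 Int.<_) cast-4N 25<4N))
  where
  cast-4N : + 4 Int.* normSq k ≡ + (4 * ‖ k ‖)
  cast-4N = trans (cong (+ 4 Int.*_) (normSq≡‖‖ k)) (sym (ℤP.pos-* 4 ‖ k ‖))

same-norm : ∀ {x y} → x ≡ y ⊎ x ≡ -ᵍ y → ‖ x ‖ ≡ ‖ y ‖
same-norm (inj₁ refl) = refl
same-norm {y = y} (inj₂ refl) = ‖-‖ y

lemma7p1 : (k : ℤ[i]) → (+ 25) Int.< (+ 4) Int.* normSq k →
           (j : Fin 6) (m n : ℕ) →
           (V k n ≡ W k j m ⊎ V k n ≡ -ᵍ W k j m) →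
           m ≤ n × n ≤ 3 * m + 2
lemma7p1 k 25<4N j m n V≡±W with ℕP.m≤n⇒∃[o]m+o≡n (norm-at-least-7 k 25<4N)
... | t , 7+t≡N =
  ℕP.≮⇒≥ (λ n<m → ℕP.<-irrefl equal (W-beats-V j {m} {n} n<m)) ,
  ℕP.≮⇒≥ (λ 3m+2<n → ℕP.<-irrefl (sym equal) (V-beats-W j {m} {n} 3m+2<n))
  where
  open Estimates k t (trans (sym 7+t≡N) (ℕP.+-comm 7 t))
  equal : ‖ V k n ‖ ≡ ‖ W k j m ‖
  equal = same-norm V≡±W
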